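{- Let $m\ge 1$ and let $G$ be a graph on $n$ vertices, $m$ of which are universal. Let $w_m$ be the smallest positive real root of $f_m(x)=x^{m+1}-x^m-2x+1$. Then $d_i(G)\ge d_{i+1}(G)$ for all $i \ge (1-w_m)n$.
   Context: $G$ is a finite simple graph. A vertex is universal if it is adjacent to every other vertex (degree $n-1$). A set $U\subseteq V(G)$ is dominating if every vertex is in $U$ or adjacent to a vertex of $U$; $d_i(G)$ is the number of dominating sets of $G$ of size $i$ (so $d_i(G)=0$ for $i>n$). -}

module Defs where

open import Data.Nat as ℕ using (ℕ; zero; suc)
open import Data.Bool using (Bool; true; false; _∧_; _∨_; not)
open import Data.Fin using (Fin)
open import Data.Fin.Subset using (Subset; ∣_∣)
open import Data.Vec using (Vec; []; _∷_; lookup)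
open import Data.List using (List; []; _∷_; map; _++_; length; filter; allFin)
open import Data.Bool.ListAction using (any; all)
open import Data.Fin.Properties using (_≟_)
open import Relation.Nullary using (¬_; does)
open import Relation.Binary.PropositionalEquality using (_≡_)
open import Data.Integer using (+_)
open import Data.Rational using (ℚ; _+_; _*_; _-_; _<_; _≤_; 0ℚ; 1ℚ; _/_)

record Graph (n : ℕ) : Set where
  field
    adj     : Fin n → Fin n → Bool
    symm    : ∀ u v → adj u v ≡ adj v u
    irrefl  : ∀ v → adj v v ≡ false
open Graph public

isUniversal : ∀ {n} → Graph n → Fin n → Bool
isUniversal {n} G v = all (λ u → does (u ≟ v) ∨ adj G v u) (allFin n)

numUniversal : ∀ {n} → Graph n → ℕ
numUniversal {n} G = length (filter (λ v → isUniversal G v ≟B true) (allFin n))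
  where
  open import Data.Bool.Properties renaming (_≟_ to _≟B_)

isDominating : ∀ {n} → Graph n → Subset n → Bool
isDominating {n} G U =
  all (λ v → lookup U v ∨ any (λ u → lookup U u ∧ adj G u v) (allFin n)) (allFin n)

allSubsets : (n : ℕ) → List (Subset n)
allSubsets zero    = [] ∷ []
allSubsets (suc n) = map (true ∷_) (allSubsets n) ++ map (false ∷_) (allSubsets n)

domCount : ∀ {n} → Graph n → ℕ → ℕ
domCount {n} G i =
  length (filter (λ U → (isDominating G U ∧ (∣ U ∣ ℕ.≡ᵇ i)) ≟B true) (allSubsets n))
  where
  open import Data.Bool.Properties renaming (_≟_ to _≟B_)

_^ℚ_ : ℚ → ℕ → ℚ
x ^ℚ zero  = 1ℚ
x ^ℚ suc k = x * (x ^ℚ k)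

f : ℕ → ℚ → ℚ
f m x = x ^ℚ suc m - x ^ℚ m - (+ 2 / 1) * x + 1ℚ

-- BelowRoot m q  :⇔  q < w_m, where w_m is the smallest positive real root of f_m.
-- Realised as the Dedekind lower cut of w_m in ℚ: f_m(0) = 1 > 0, so q < w_m
-- iff f_m has no zero and stays positive on (0, q].
BelowRoot : ℕ → ℚ → Set
BelowRoot m q = ∀ (y : ℚ) → 0ℚ < y → y ≤ q → 0ℚ < f m y

-- Every set containing one of the m universal vertices dominates, so at least
-- C(n,i) - C(n-m,i) of the i-sets are dominating, while at most C(n,i+1) of the (i+1)-sets
-- are; it suffices to show C(n,i+1) + C(n-m,i) <= C(n,i).  With j = n - i we have
-- C(n,i+1)/C(n,i) <= j/i and C(n-m,i)/C(n,i) <= (j/n)^m, and for y = j/n = 1 - i/n the bound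
-- j/i + y^m < 1 is f_m(y) > 0 with denominators cleared, which is what y < w_m provides.
module Submission where

open import Defs
open import Data.Nat using (ℕ; suc; _≤_; _≥_; >-nonZero)
open import Data.Integer using (+_)
open import Data.Rational using (_-_; _/_; 1ℚ)
open import Relation.Binary.PropositionalEquality using (_≡_)

open import Data.Bool using (Bool; true; false; T; _∧_; _∨_; not)
open import Data.Bool.ListAction using (any)
open import Data.Bool.Properties using (_≟_; ∧-zeroʳ; ∧-identityʳ; T-∧; T-∨; T-≡)
open import Data.Empty using (⊥-elim)
open import Data.Fin using (Fin; zero; suc)
import Data.Fin.Properties as Fin
open import Data.Fin.Subset using (Subset; ∣_∣; _⊈_; _∈_; _∉_; inside; outside; ⊤)
open import Data.Fin.Subset.Properties using (_⊆?_; _∈?_; ⊆⊤; ∣⊤∣≡n)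
open import Data.Integer as ℤ using (ℤ)
import Data.Integer.Properties as ℤ
import Data.Integer.Tactic.RingSolver as ℤ
open import Data.List as List using (List; []; _∷_; map; _++_; length; filter; allFin)
open import Data.List.Membership.Propositional using (lose)
open import Data.List.Membership.Propositional.Properties using (∈-allFin)
open import Data.List.Properties using (length-++; filter-++)
import Data.List.Relation.Unary.All as All
open import Data.List.Relation.Unary.All.Properties using (all⁺; all⁻)
open import Data.List.Relation.Unary.Any.Properties using (any⁺)
open import Data.Nat using (zero; _+_; _*_; _^_; _<_; z≤n; s≤s; _≡ᵇ_; _∸_; _<?_)
open import Data.Nat.Combinatorics using (_C_; nCk+nC[k+1]≡[n+1]C[k+1]; k>n⇒nCk≡0)
open import Data.Nat.Properties
  using ( ≤-refl; ≤-trans; ≤-reflexive; ≤-<-trans; <⇒≤; ≮⇒≥; n≤1+n; m≤m+n; m≤n⇒m≤1+n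
        ; +-comm; +-suc; +-identityʳ; *-comm; *-assoc; *-zeroʳ; *-distribʳ-+
        ; +-monoˡ-≤; +-monoʳ-≤; +-mono-≤; *-monoˡ-≤; *-monoʳ-≤
        ; +-cancelʳ-≡; +-cancelˡ-≤; +-cancelʳ-≤; *-cancelˡ-≤; m+[n∸m]≡n; m<n⇒0<n∸m
        ; *-commutativeSemigroup; module ≤-Reasoning )
open import Data.Nat.Tactic.RingSolver using (solve-∀)
open import Data.Product using (∃; _×_; _,_; proj₂)
open import Data.Rational as ℚ using (0ℚ; toℚᵘ)
import Data.Rational.Properties as ℚ
open import Data.Rational.Unnormalised as ℚᵘ using (ℚᵘ; mkℚᵘ; ↥_; ↧_; _≃_; *≡*)
import Data.Rational.Unnormalised.Properties as ℚᵘ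
open import Data.Sum using (inj₁; inj₂)
open import Data.Unit using (tt)
open import Data.Vec as Vec using (lookup; []; _∷_)
open import Data.Vec.Properties using (lookup∘tabulate; []=⇒lookup; lookup⇒[]=)
open import Function using (_∘_; const; Equivalence)
open import Relation.Nullary using (does; yes; no)
open import Relation.Nullary.Decidable using (dec-true; dec-false; decidable-stable; _→-dec_)
open import Relation.Binary.PropositionalEquality
  using (refl; sym; trans; cong; cong₂; subst; module ≡-Reasoning)

open import Algebra.Properties.CommutativeSemigroup *-commutativeSemigroup using (x∙yz≈y∙xz; xy∙z≈y∙xz)
open Equivalence using (to; from)

private
  variable
    A B : Set

[k+1]*nC[k+1]+k*nCk≡n*nCk : ∀ n k → suc k * (n C suc k) + k * (n C k) ≡ n * (n C k)
[k+1]*nC[k+1]+k*nCk≡n*nCk zero    zero    = refl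
[k+1]*nC[k+1]+k*nCk≡n*nCk zero    (suc k) = cong₂ _+_ (*-zeroʳ (2 + k)) (*-zeroʳ (suc k))
[k+1]*nC[k+1]+k*nCk≡n*nCk (suc n) zero    = begin
  1 * (suc n C 1) + 0  ≡⟨ cong (λ c → 1 * c + 0) (nCk+nC[k+1]≡[n+1]C[k+1] n 0) ⟨
  1 * (1 + n C 1) + 0  ≡⟨ cong suc ([k+1]*nC[k+1]+k*nCk≡n*nCk n 0) ⟩
  suc n * 1            ∎
  where open ≡-Reasoning
[k+1]*nC[k+1]+k*nCk≡n*nCk (suc n) (suc k) = begin
  (2 + k) * (suc n C (2 + k)) + suc k * (suc n C suc k)
    ≡⟨ cong₂ (λ x y → (2 + k) * x + suc k * y)
             (nCk+nC[k+1]≡[n+1]C[k+1] n (suc k)) (nCk+nC[k+1]≡[n+1]C[k+1] n k) ⟨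
  (2 + k) * (b + c) + suc k * (a + b)
    ≡⟨ regroup k a b c ⟩
  ((2 + k) * c + suc k * b) + (suc k * b + k * a) + (a + b)
    ≡⟨ cong₂ (λ x y → x + y + (a + b))
             ([k+1]*nC[k+1]+k*nCk≡n*nCk n (suc k)) ([k+1]*nC[k+1]+k*nCk≡n*nCk n k) ⟩
  n * b + n * a + (a + b)
    ≡⟨ collect n a b ⟩
  suc n * (a + b)
    ≡⟨ cong (suc n *_) (nCk+nC[k+1]≡[n+1]C[k+1] n k) ⟩
  suc n * (suc n C suc k) ∎
  where
  open ≡-Reasoning
  a = n C k
  b = n C suc k
  c = n C (2 + k)
  regroup : ∀ k a b c → (2 + k) * (b + c) + suc k * (a + b)
                      ≡ ((2 + k) * c + suc k * b) + (suc k * b + k * a) + (a + b)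
  regroup = solve-∀
  collect : ∀ n a b → n * b + n * a + (a + b) ≡ suc n * (a + b)
  collect = solve-∀

k*[k+j]C[k+1]≤j*[k+j]Ck : ∀ k j → k * ((k + j) C suc k) ≤ j * ((k + j) C k)
k*[k+j]C[k+1]≤j*[k+j]Ck k j = begin
  k * X      ≤⟨ *-monoˡ-≤ X (n≤1+n k) ⟩
  suc k * X  ≡⟨ +-cancelʳ-≡ (k * Y) (suc k * X) (j * Y) [k+1]X+kY≡jY+kY ⟩
  j * Y      ∎
  where
  open ≤-Reasoning
  X = (k + j) C suc k
  Y = (k + j) C k
  [k+1]X+kY≡jY+kY : suc k * X + k * Y ≡ j * Y + k * Y
  [k+1]X+kY≡jY+kY = trans ([k+1]*nC[k+1]+k*nCk≡n*nCk (k + j) k)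
                          (trans (*-distribʳ-+ Y k j) (+-comm (k * Y) (j * Y)))

nCk*[k+j]≤[1+n]Ck*j : ∀ {n k j} → suc n ≤ k + j → (n C k) * (k + j) ≤ (suc n C k) * j
nCk*[k+j]≤[1+n]Ck*j {n} {zero}  {j} _ = ≤-refl
nCk*[k+j]≤[1+n]Ck*j {n} {suc k} {j} (s≤s n≤k+j) = begin
  b * (suc k + j)        ≡⟨ distrib b k j ⟩
  suc k * b + b * j      ≤⟨ +-monoˡ-≤ (b * j) [k+1]b≤ja ⟩
  j * a + b * j          ≡⟨ collect a b j ⟩
  (a + b) * j            ≡⟨ cong (_* j) (nCk+nC[k+1]≡[n+1]C[k+1] n k) ⟩
  (suc n C suc k) * j    ∎
  where
  open ≤-Reasoning
  a = n C k
  b = n C suc k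
  [k+1]b≤ja : suc k * b ≤ j * a
  [k+1]b≤ja = +-cancelʳ-≤ (k * a) _ _ (begin
    suc k * b + k * a  ≡⟨ [k+1]*nC[k+1]+k*nCk≡n*nCk n k ⟩
    n * a              ≤⟨ *-monoˡ-≤ a n≤k+j ⟩
    (k + j) * a        ≡⟨ *-distribʳ-+ a k j ⟩
    k * a + j * a      ≡⟨ +-comm (k * a) (j * a) ⟩
    j * a + k * a      ∎)
  distrib : ∀ b k j → b * (suc k + j) ≡ suc k * b + b * j
  distrib = solve-∀
  collect : ∀ a b j → j * a + b * j ≡ (a + b) * j
  collect = solve-∀

nCk*[k+j]^m≤[k+j]Ck*j^m : ∀ {n m k j} → n + m ≡ k + j → (n C k) * (k + j) ^ m ≤ ((k + j) C k) * j ^ m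
nCk*[k+j]^m≤[k+j]Ck*j^m {n} {zero}  {k} {j} n+0≡N rewrite +-identityʳ n | n+0≡N = ≤-refl
nCk*[k+j]^m≤[k+j]Ck*j^m {n} {suc m} {k} {j} n+[m+1]≡N = begin
  (n C k) * (N * N ^ m)      ≡⟨ *-assoc (n C k) N (N ^ m) ⟨
  (n C k) * N * N ^ m        ≤⟨ *-monoˡ-≤ (N ^ m) (nCk*[k+j]≤[1+n]Ck*j {k = k} {j} 1+n≤N) ⟩
  (suc n C k) * j * N ^ m    ≡⟨ xy∙z≈y∙xz (suc n C k) j (N ^ m) ⟩
  j * ((suc n C k) * N ^ m)  ≤⟨ *-monoʳ-≤ j (nCk*[k+j]^m≤[k+j]Ck*j^m {k = k} {j} 1+n+m≡N) ⟩
  j * ((N C k) * j ^ m)      ≡⟨ x∙yz≈y∙xz j (N C k) (j ^ m) ⟩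
  (N C k) * (j * j ^ m)      ∎
  where
  open ≤-Reasoning
  N = k + j
  1+n+m≡N : suc n + m ≡ N
  1+n+m≡N = trans (sym (+-suc n m)) n+[m+1]≡N
  1+n≤N : suc n ≤ N
  1+n≤N = subst (suc n ≤_) 1+n+m≡N (m≤m+n (suc n) m)

NC[k+1]+nCk≤NCk : ∀ {N n m k j} → k + j ≡ N → n + m ≡ N →
                  j ^ m * k + j * N ^ m < N ^ m * k → N C suc k + n C k ≤ N C k
NC[k+1]+nCk≤NCk {N} {n} {m} {k} {j} refl n+m≡N bound =
  *-cancelˡ-≤ (P * k) {{>-nonZero (≤-<-trans z≤n bound)}} (begin
    P * k * (a′ + c)            ≡⟨ expand P k a′ c ⟩
    P * (k * a′) + k * (c * P)  ≤⟨ +-mono-≤ (*-monoʳ-≤ P (k*[k+j]C[k+1]≤j*[k+j]Ck k j))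
                                           (*-monoʳ-≤ k (nCk*[k+j]^m≤[k+j]Ck*j^m {k = k} {j} n+m≡N)) ⟩
    P * (j * a) + k * (a * Q)   ≡⟨ factor P j a k Q ⟩
    a * (Q * k + j * P)         ≤⟨ *-monoʳ-≤ a (<⇒≤ bound) ⟩
    a * (P * k)                 ≡⟨ *-comm a (P * k) ⟩
    P * k * a                   ∎)
  where
  open ≤-Reasoning
  P = N ^ m
  Q = j ^ m
  a = N C k
  a′ = N C suc k
  c = n C k
  expand : ∀ P k a′ c → P * k * (a′ + c) ≡ P * (k * a′) + k * (c * P)
  expand = solve-∀
  factor : ∀ P j a k Q → P * (j * a) + k * (a * Q) ≡ a * (Q * k + j * P)
  factor = solve-∀

_^ᵘ_ : ℚᵘ → ℕ → ℚᵘ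
p ^ᵘ zero  = ℚᵘ.1ℚᵘ
p ^ᵘ suc k = p ℚᵘ.* p ^ᵘ k

-- ℚ normalises fractions, so f is evaluated on unnormalised rationals, whose numerators can be
-- read off syntactically.
fᵘ : ℕ → ℚᵘ → ℚᵘ
fᵘ m p = p ^ᵘ suc m ℚᵘ.- p ^ᵘ m ℚᵘ.- mkℚᵘ (+ 2) 0 ℚᵘ.* p ℚᵘ.+ ℚᵘ.1ℚᵘ

^ᵘ-cong : ∀ {p q} k → p ≃ q → p ^ᵘ k ≃ q ^ᵘ k
^ᵘ-cong zero    p≃q = ℚᵘ.≃-refl
^ᵘ-cong (suc k) p≃q = ℚᵘ.*-cong p≃q (^ᵘ-cong k p≃q)

fᵘ-cong : ∀ m {p q} → p ≃ q → fᵘ m p ≃ fᵘ m q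
fᵘ-cong m p≃q = ℚᵘ.+-congˡ ℚᵘ.1ℚᵘ (ℚᵘ.+-cong
  (ℚᵘ.+-cong (^ᵘ-cong (suc m) p≃q) (ℚᵘ.-‿cong (^ᵘ-cong m p≃q)))
  (ℚᵘ.-‿cong (ℚᵘ.*-congˡ {mkℚᵘ (+ 2) 0} p≃q)))

toℚᵘ-homo-^ : ∀ p k → toℚᵘ (p ^ℚ k) ≃ toℚᵘ p ^ᵘ k
toℚᵘ-homo-^ p zero    = ℚᵘ.≃-refl
toℚᵘ-homo-^ p (suc k) = ℚᵘ.≃-trans (ℚ.toℚᵘ-homo-* p (p ^ℚ k)) (ℚᵘ.*-congˡ {toℚᵘ p} (toℚᵘ-homo-^ p k))

toℚᵘ-homo-- : ∀ p q → toℚᵘ (p - q) ≃ toℚᵘ p ℚᵘ.- toℚᵘ q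
toℚᵘ-homo-- p q = ℚᵘ.≃-trans (ℚ.toℚᵘ-homo-+ p (ℚ.- q)) (ℚᵘ.+-congʳ (toℚᵘ p) (ℚ.toℚᵘ-homo‿- q))

toℚᵘ-homo-f : ∀ m p → toℚᵘ (f m p) ≃ fᵘ m (toℚᵘ p)
toℚᵘ-homo-f m p =
  ℚᵘ.≃-trans (ℚ.toℚᵘ-homo-+ (a - b - c) 1ℚ) (ℚᵘ.+-congˡ ℚᵘ.1ℚᵘ
    (ℚᵘ.≃-trans (toℚᵘ-homo-- (a - b) c) (ℚᵘ.+-cong
      (ℚᵘ.≃-trans (toℚᵘ-homo-- a b) (ℚᵘ.+-cong (toℚᵘ-homo-^ p (suc m)) (ℚᵘ.-‿cong (toℚᵘ-homo-^ p m))))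
      (ℚᵘ.-‿cong (ℚ.toℚᵘ-homo-* (+ 2 / 1) p)))))
  where
  a = p ^ℚ suc m
  b = p ^ℚ m
  c = (+ 2 / 1) ℚ.* p

↥-* : ∀ p q → ↥ (p ℚᵘ.* q) ≡ ↥ p ℤ.* ↥ q
↥-* (mkℚᵘ _ _) (mkℚᵘ _ _) = refl

↧-* : ∀ p q → ↧ (p ℚᵘ.* q) ≡ ↧ p ℤ.* ↧ q
↧-* (mkℚᵘ _ _) (mkℚᵘ _ _) = refl

↥-^ᵘ : ∀ p k → ↥ (p ^ᵘ k) ≡ ↥ p ℤ.^ k
↥-^ᵘ p zero    = refl
↥-^ᵘ p (suc k) = trans (↥-* p (p ^ᵘ k)) (cong (↥ p ℤ.*_) (↥-^ᵘ p k))

↧-^ᵘ : ∀ p k → ↧ (p ^ᵘ k) ≡ ↧ p ℤ.^ k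
↧-^ᵘ p zero    = refl
↧-^ᵘ p (suc k) = trans (↧-* p (p ^ᵘ k)) (cong (↧ p ℤ.*_) (↧-^ᵘ p k))

↥[p-q-r+1] : ∀ p q r {a b c x y z} → ↥ p ≡ a → ↥ q ≡ b → ↥ r ≡ c → ↧ p ≡ x → ↧ q ≡ y → ↧ r ≡ z →
  ↥ (p ℚᵘ.- q ℚᵘ.- r ℚᵘ.+ ℚᵘ.1ℚᵘ) ≡ (a ℤ.* y ℤ.- b ℤ.* x) ℤ.* z ℤ.- c ℤ.* (x ℤ.* y) ℤ.+ x ℤ.* y ℤ.* z
↥[p-q-r+1] (mkℚᵘ a d) (mkℚᵘ b e) (mkℚᵘ c f) refl refl refl refl refl refl =
  tidy a b c (+ suc d) (+ suc e) (+ suc f)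
  where
  -- the left-hand side is the numerator exactly as ℚᵘ's _+_ and _*_ compute it
  tidy : ∀ a b c x y z →
    ((a ℤ.* y ℤ.+ ℤ.- b ℤ.* x) ℤ.* z ℤ.+ ℤ.- c ℤ.* (x ℤ.* y)) ℤ.* ℤ.1ℤ ℤ.+ ℤ.1ℤ ℤ.* (x ℤ.* y ℤ.* z)
      ≡ (a ℤ.* y ℤ.- b ℤ.* x) ℤ.* z ℤ.- c ℤ.* (x ℤ.* y) ℤ.+ x ℤ.* y ℤ.* z
  tidy = ℤ.solve-∀

-- fʰ m a b = b ^ (m + 1) * f m (a / b), the homogenisation of f m.
fʰ : ℕ → ℤ → ℤ → ℤ
fʰ m a b = a ℤ.^ suc m ℤ.- a ℤ.^ m ℤ.* b ℤ.- + 2 ℤ.* a ℤ.* b ℤ.^ m ℤ.+ b ℤ.^ suc m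

↥-fᵘ : ∀ m p → ↥ (fᵘ m p) ≡ ↧ p ℤ.^ suc m ℤ.* fʰ m (↥ p) (↧ p)
↥-fᵘ m p = trans
  (↥[p-q-r+1] (p ^ᵘ suc m) (p ^ᵘ m) (two ℚᵘ.* p)
     (↥-^ᵘ p (suc m)) (↥-^ᵘ p m) (↥-* two p) (↧-^ᵘ p (suc m)) (↧-^ᵘ p m) (↧-* two p))
  (homogenise (↥ p) (↧ p) (↥ p ℤ.^ m) (↧ p ℤ.^ m))
  where
  two = mkℚᵘ (+ 2) 0
  homogenise : ∀ a b aᵐ bᵐ →
    (a ℤ.* aᵐ ℤ.* bᵐ ℤ.- aᵐ ℤ.* (b ℤ.* bᵐ)) ℤ.* (ℤ.1ℤ ℤ.* b) ℤ.- + 2 ℤ.* a ℤ.* (b ℤ.* bᵐ ℤ.* bᵐ)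
      ℤ.+ b ℤ.* bᵐ ℤ.* bᵐ ℤ.* (ℤ.1ℤ ℤ.* b)
      ≡ b ℤ.* bᵐ ℤ.* (a ℤ.* aᵐ ℤ.- aᵐ ℤ.* b ℤ.- + 2 ℤ.* a ℤ.* bᵐ ℤ.+ b ℤ.* bᵐ)
  homogenise = ℤ.solve-∀

pos-^ : ∀ a k → + (a ^ k) ≡ (+ a) ℤ.^ k
pos-^ a zero    = refl
pos-^ a (suc k) = trans (ℤ.pos-* a (a ^ k)) (cong (+ a ℤ.*_) (pos-^ a k))

+[j^m*i+j*n^m]+fʰ≡+[n^m*i] : ∀ m i j {n} → i + j ≡ n →
  + (j ^ m * i + j * n ^ m) ℤ.+ fʰ m (+ j) (+ n) ≡ + (n ^ m * i)
+[j^m*i+j*n^m]+fʰ≡+[n^m*i] m i j refl = begin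
  + (j ^ m * i + j * n ^ m) ℤ.+ fʰ m (+ j) (+ n)
    ≡⟨ cong (ℤ._+ fʰ m (+ j) (+ n)) (trans (ℤ.pos-+ (j ^ m * i) (j * n ^ m))
         (cong₂ ℤ._+_ (+[x^m*i] j) (trans (ℤ.pos-* j (n ^ m)) (cong (+ j ℤ.*_) (pos-^ n m))))) ⟩
  jᵐ ℤ.* + i ℤ.+ + j ℤ.* nᵐ ℤ.+ fʰ m (+ j) (+ n)
    ≡⟨ cong (λ b → jᵐ ℤ.* + i ℤ.+ + j ℤ.* nᵐ ℤ.+ (+ j ℤ.* jᵐ ℤ.- jᵐ ℤ.* b ℤ.- + 2 ℤ.* + j ℤ.* nᵐ ℤ.+ b ℤ.* nᵐ))
            (ℤ.pos-+ i j) ⟩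
  jᵐ ℤ.* + i ℤ.+ + j ℤ.* nᵐ
    ℤ.+ (+ j ℤ.* jᵐ ℤ.- jᵐ ℤ.* (+ i ℤ.+ + j) ℤ.- + 2 ℤ.* + j ℤ.* nᵐ ℤ.+ (+ i ℤ.+ + j) ℤ.* nᵐ)
    ≡⟨ cancel (+ j) jᵐ (+ i) nᵐ ⟩
  nᵐ ℤ.* + i
    ≡⟨ +[x^m*i] n ⟨
  + (n ^ m * i) ∎
  where
  open ≡-Reasoning
  n = i + j
  jᵐ = (+ j) ℤ.^ m
  nᵐ = (+ n) ℤ.^ m
  +[x^m*i] : ∀ x → + (x ^ m * i) ≡ (+ x) ℤ.^ m ℤ.* + i
  +[x^m*i] x = trans (ℤ.pos-* (x ^ m) i) (cong (ℤ._* + i) (pos-^ x m))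
  cancel : ∀ a aᵐ ι bᵐ → aᵐ ℤ.* ι ℤ.+ a ℤ.* bᵐ
             ℤ.+ (a ℤ.* aᵐ ℤ.- aᵐ ℤ.* (ι ℤ.+ a) ℤ.- + 2 ℤ.* a ℤ.* bᵐ ℤ.+ (ι ℤ.+ a) ℤ.* bᵐ) ≡ bᵐ ℤ.* ι
  cancel = ℤ.solve-∀

1-i/n≃j/n : ∀ {i j d} → i + j ≡ suc d → toℚᵘ (1ℚ - + i / suc d) ≃ mkℚᵘ (+ j) d
1-i/n≃j/n {i} {j} {d} i+j≡n = ℚᵘ.≃-trans (toℚᵘ-homo-- 1ℚ (+ i / suc d))
  (ℚᵘ.≃-trans (ℚᵘ.+-congʳ ℚᵘ.1ℚᵘ (ℚᵘ.-‿cong (ℚ.toℚᵘ-fromℚᵘ (mkℚᵘ (+ i) d))))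
  (*≡* (subst (λ n → (ℤ.1ℤ ℤ.* n ℤ.+ ℤ.- + i ℤ.* ℤ.1ℤ) ℤ.* n ≡ + j ℤ.* (ℤ.1ℤ ℤ.* n))
              (trans (sym (ℤ.pos-+ i j)) (cong +_ i+j≡n))
              (clear (+ i) (+ j)))))
  where
  clear : ∀ a b → (ℤ.1ℤ ℤ.* (a ℤ.+ b) ℤ.+ ℤ.- a ℤ.* ℤ.1ℤ) ℤ.* (a ℤ.+ b) ≡ b ℤ.* (ℤ.1ℤ ℤ.* (a ℤ.+ b))
  clear = ℤ.solve-∀

belowRoot⇒j^m*i+j*n^m<n^m*i : ∀ {m i j d} → i + j ≡ suc d → 0 < j →
  BelowRoot m (1ℚ - + i / suc d) → j ^ m * i + j * suc d ^ m < suc d ^ m * i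
belowRoot⇒j^m*i+j*n^m<n^m*i {m} {i} {j} {d} i+j≡n 0<j below = ℤ.drop‿+<+ (begin-strict
  + lhs                        ≡⟨ ℤ.+-identityʳ (+ lhs) ⟨
  + lhs ℤ.+ ℤ.0ℤ               <⟨ ℤ.+-monoʳ-< (+ lhs) 0<fʰ ⟩
  + lhs ℤ.+ fʰ m (+ j) (+ n)   ≡⟨ +[j^m*i+j*n^m]+fʰ≡+[n^m*i] m i j i+j≡n ⟩
  + (n ^ m * i)                ∎)
  where
  open ℤ.≤-Reasoning
  n = suc d
  lhs = j ^ m * i + j * n ^ m
  y = 1ℚ - + i / n
  x = mkℚᵘ (+ j) d
  y≃x : toℚᵘ y ≃ x
  y≃x = 1-i/n≃j/n i+j≡n
  0<x : ℚᵘ.0ℚᵘ ℚᵘ.< x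
  0<x = ℚᵘ.positive⁻¹ x {{ℤ.positive (ℤ.+<+ 0<j)}}
  0<y : 0ℚ ℚ.< y
  0<y = ℚ.toℚᵘ-cancel-< (ℚᵘ.<-respʳ-≃ (ℚᵘ.≃-sym y≃x) 0<x)
  0<fᵘx : ℚᵘ.0ℚᵘ ℚᵘ.< fᵘ m x
  0<fᵘx = ℚᵘ.<-respʳ-≃ (ℚᵘ.≃-trans (toℚᵘ-homo-f m y) (fᵘ-cong m y≃x))
                       (ℚ.toℚᵘ-mono-< (below y 0<y ℚ.≤-refl))
  nᵐ⁺¹ = + (n ^ suc m)
  0<nᵐ⁺¹*fʰ : ℤ.0ℤ ℤ.< nᵐ⁺¹ ℤ.* fʰ m (+ j) (+ n)
  0<nᵐ⁺¹*fʰ = subst (ℤ.0ℤ ℤ.<_) (trans (↥-fᵘ m x) (cong (ℤ._* fʰ m (+ j) (+ n)) (sym (pos-^ n (suc m)))))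
                    (ℤ.positive⁻¹ (↥ fᵘ m x) {{ℚᵘ.positive 0<fᵘx}})
  0<fʰ : ℤ.0ℤ ℤ.< fʰ m (+ j) (+ n)
  0<fʰ = ℤ.*-cancelˡ-<-nonNeg nᵐ⁺¹
           (subst (ℤ._< nᵐ⁺¹ ℤ.* fʰ m (+ j) (+ n)) (sym (ℤ.*-zeroʳ nᵐ⁺¹)) 0<nᵐ⁺¹*fʰ)

count : (A → Bool) → List A → ℕ
count p = length ∘ filter (λ x → p x ≟ true)

count-mono : ∀ {p q : A → Bool} → (∀ x → T (p x) → T (q x)) → ∀ xs → count p xs ≤ count q xs
count-mono p⇒q [] = z≤n
count-mono {p = p} {q} p⇒q (x ∷ xs) with p x in px | q x in qx
... | true  | true  = s≤s (count-mono p⇒q xs)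
... | true  | false = ⊥-elim (subst T qx (p⇒q x (subst T (sym px) tt)))
... | false | true  = m≤n⇒m≤1+n (count-mono p⇒q xs)
... | false | false = count-mono p⇒q xs

count-cong : ∀ {p q : A → Bool} → (∀ x → p x ≡ q x) → ∀ xs → count p xs ≡ count q xs
count-cong p≗q [] = refl
count-cong {q = q} p≗q (x ∷ xs) rewrite p≗q x with q x
... | true  = cong suc (count-cong p≗q xs)
... | false = count-cong p≗q xs

count-none : ∀ {p : A → Bool} → (∀ x → p x ≡ false) → ∀ xs → count p xs ≡ 0
count-none p≡false [] = refl
count-none p≡false (x ∷ xs) rewrite p≡false x = count-none p≡false xs

count-++ : ∀ (p : A → Bool) xs ys → count p (xs ++ ys) ≡ count p xs + count p ys
count-++ p xs ys = trans (cong length (filter-++ _ xs ys)) (length-++ (filter _ xs))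

count-map : ∀ (p : B → Bool) (f : A → B) xs → count p (map f xs) ≡ count (p ∘ f) xs
count-map p f [] = refl
count-map p f (x ∷ xs) with p (f x)
... | true  = cong suc (count-map p f xs)
... | false = count-map p f xs

count-∧-split : ∀ (p q : A → Bool) xs →
                count (λ x → p x ∧ q x) xs + count (λ x → p x ∧ not (q x)) xs ≡ count p xs
count-∧-split p q [] = refl
count-∧-split p q (x ∷ xs) with p x | q x
... | true  | true  = cong suc (count-∧-split p q xs)
... | true  | false = trans (+-suc _ _) (cong suc (count-∧-split p q xs))
... | false | _     = count-∧-split p q xs

∣tabulate-not∣+count≡n : ∀ {n} (p : A → Bool) (g : Fin n → A) →
                          ∣ Vec.tabulate (not ∘ p ∘ g) ∣ + count p (List.tabulate g) ≡ n
∣tabulate-not∣+count≡n {n = zero}  p g = refl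
∣tabulate-not∣+count≡n {n = suc n} p g with p (g zero)
... | true  = trans (+-suc _ _) (cong suc (∣tabulate-not∣+count≡n p (g ∘ suc)))
... | false = cong suc (∣tabulate-not∣+count≡n p (g ∘ suc))

count-⊆-of-size : ∀ {n} (W : Subset n) k →
                  count (λ U → (∣ U ∣ ≡ᵇ k) ∧ does (U ⊆? W)) (allSubsets n) ≡ ∣ W ∣ C k
count-⊆-of-size []      zero    = refl
count-⊆-of-size []      (suc k) = refl
count-⊆-of-size {suc n} (w ∷ W) k = begin
  count P (map (inside ∷_) S ++ map (outside ∷_) S)
    ≡⟨ count-++ P (map (inside ∷_) S) (map (outside ∷_) S) ⟩
  count P (map (inside ∷_) S) + count P (map (outside ∷_) S)
    ≡⟨ cong₂ _+_ (count-map P (inside ∷_) S) (count-map P (outside ∷_) S) ⟩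
  count (P ∘ (inside ∷_)) S + count (P ∘ (outside ∷_)) S
    ≡⟨ by-first-element w k ⟩
  ∣ w ∷ W ∣ C k ∎
  where
  open ≡-Reasoning
  S = allSubsets n
  P : Subset (suc n) → Bool
  P U = (∣ U ∣ ≡ᵇ k) ∧ does (U ⊆? w ∷ W)
  by-first-element : ∀ w k →
    count (λ U → (suc ∣ U ∣ ≡ᵇ k) ∧ does (inside ∷ U ⊆? w ∷ W)) S
      + count (λ U → (∣ U ∣ ≡ᵇ k) ∧ does (U ⊆? W)) S ≡ ∣ w ∷ W ∣ C k
  by-first-element outside k       = cong₂ _+_ (count-none (λ _ → ∧-zeroʳ _) S) (count-⊆-of-size W k)
  by-first-element inside  zero    = cong₂ _+_ (count-none (λ _ → refl) S) (count-⊆-of-size W zero)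
  by-first-element inside  (suc k) = trans (cong₂ _+_ (count-⊆-of-size W k) (count-⊆-of-size W (suc k)))
                                           (nCk+nC[k+1]≡[n+1]C[k+1] ∣ W ∣ k)

count-of-size : ∀ n k → count (λ U → ∣ U ∣ ≡ᵇ k) (allSubsets n) ≡ n C k
count-of-size n k = begin
  count (λ U → ∣ U ∣ ≡ᵇ k) (allSubsets n)                    ≡⟨ count-cong ≡∧⊆⊤ (allSubsets n) ⟩
  count (λ U → (∣ U ∣ ≡ᵇ k) ∧ does (U ⊆? ⊤)) (allSubsets n)  ≡⟨ count-⊆-of-size {n} ⊤ k ⟩
  ∣ ⊤ {n} ∣ C k                                              ≡⟨ cong (_C k) (∣⊤∣≡n n) ⟩
  n C k                                                      ∎
  where
  open ≡-Reasoning
  ≡∧⊆⊤ : ∀ U → (∣ U ∣ ≡ᵇ k) ≡ (∣ U ∣ ≡ᵇ k) ∧ does (U ⊆? ⊤)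
  ≡∧⊆⊤ U = sym (trans (cong ((∣ U ∣ ≡ᵇ k) ∧_) (dec-true (U ⊆? ⊤) ⊆⊤)) (∧-identityʳ _))

⊈⇒∃∈∉ : ∀ {n} {U W : Subset n} → U ⊈ W → ∃ λ v → v ∈ U × v ∉ W
⊈⇒∃∈∉ {n} {U} {W} U⊈W with Fin.¬∀⟶∃¬ n (λ v → v ∈ U → v ∈ W) (λ v → v ∈? U →-dec v ∈? W) (λ h → U⊈W (h _))
... | v , v∈U↛v∈W = v , decidable-stable (v ∈? U) (λ v∉U → v∈U↛v∈W (⊥-elim ∘ v∉U)) , v∈U↛v∈W ∘ const

nonUniversal : ∀ {n} → Graph n → Subset n
nonUniversal G = Vec.tabulate (not ∘ isUniversal G)

∣nonUniversal∣+numUniversal≡n : ∀ {n} (G : Graph n) → ∣ nonUniversal G ∣ + numUniversal G ≡ n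
∣nonUniversal∣+numUniversal≡n G = ∣tabulate-not∣+count≡n (isUniversal G) (λ v → v)

∉nonUniversal⇒universal : ∀ {n} (G : Graph n) {v} → v ∉ nonUniversal G → T (isUniversal G v)
∉nonUniversal⇒universal G {v} v∉W with isUniversal G v in eq
... | true  = tt
... | false = v∉W (lookup⇒[]= v (nonUniversal G) (trans (lookup∘tabulate _ v) (cong not eq)))

universal∈⇒dominating : ∀ {n} (G : Graph n) {U v} → T (isUniversal G v) → v ∈ U → T (isDominating G U)
universal∈⇒dominating {n} G {U} {v} universal v∈U = all⁻ _ (All.universal dominated (allFin n))
  where
  U∋v : T (lookup U v)
  U∋v = from T-≡ ([]=⇒lookup v∈U)
  dominated : ∀ w → T (lookup U w ∨ any (λ u → lookup U u ∧ adj G u w) (allFin n))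
  dominated w with w Fin.≟ v
  ... | yes refl = from T-∨ (inj₁ U∋v)
  ... | no  w≢v  = from T-∨ (inj₂ (any⁺ _ (lose (∈-allFin v) (from T-∧ (U∋v , v~w)))))
    where
    v~w : T (adj G v w)
    v~w with All.lookup (all⁺ _ (allFin n) universal) (∈-allFin w)
    ... | v~w rewrite dec-false (w Fin.≟ v) w≢v = v~w

⊈nonUniversal⇒dominating : ∀ {n} (G : Graph n) {U} → U ⊈ nonUniversal G → T (isDominating G U)
⊈nonUniversal⇒dominating G U⊈W with ⊈⇒∃∈∉ U⊈W
... | v , v∈U , v∉W = universal∈⇒dominating G (∉nonUniversal⇒universal G v∉W) v∈U

domCount≤nCk : ∀ {n} (G : Graph n) k → domCount G k ≤ n C k
domCount≤nCk {n} G k =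
  ≤-trans (count-mono (λ _ → proj₂ ∘ to T-∧) (allSubsets n)) (≤-reflexive (count-of-size n k))

nCk≤∣nonUniversal∣Ck+domCount : ∀ {n} (G : Graph n) k → n C k ≤ ∣ nonUniversal G ∣ C k + domCount G k
nCk≤∣nonUniversal∣Ck+domCount {n} G k = begin
  n C k
    ≡⟨ count-of-size n k ⟨
  count size≡k S
    ≡⟨ count-∧-split size≡k ⊆W S ⟨
  count (λ U → size≡k U ∧ ⊆W U) S + count (λ U → size≡k U ∧ not (⊆W U)) S
    ≤⟨ +-mono-≤ (≤-reflexive (count-⊆-of-size W k)) (count-mono dominating S) ⟩
  ∣ W ∣ C k + domCount G k ∎
  where
  open ≤-Reasoning
  W = nonUniversal G
  S = allSubsets n
  size≡k ⊆W : Subset n → Bool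
  size≡k U = ∣ U ∣ ≡ᵇ k
  ⊆W U = does (U ⊆? W)
  dominating : ∀ U → T (size≡k U ∧ not (⊆W U)) → T (isDominating G U ∧ size≡k U)
  dominating U h with to T-∧ h
  ... | size , not[U⊆W] = from T-∧ (⊈nonUniversal⇒dominating G U⊈W , size)
    where
    U⊈W : U ⊈ W
    U⊈W U⊆W = subst (T ∘ not) (dec-true (U ⊆? W) U⊆W) not[U⊆W]

theorem7p2 : ∀ (m n : ℕ) → m ≥ 1 → (G : Graph n) → numUniversal G ≡ m →
    ∀ (i : ℕ) → (nz : 1 ≤ n) →
    BelowRoot m (1ℚ - (+ i / n) {{>-nonZero nz}}) →
    domCount G i ≥ domCount G (suc i)
theorem7p2 m (suc d) _ G #universal≡m i (s≤s z≤n) below with i <? suc d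
... | no i≮n = ≤-trans (domCount≤nCk G (suc i)) (≤-trans (≤-reflexive (k>n⇒nCk≡0 (s≤s (≮⇒≥ i≮n)))) z≤n)
... | yes i<n = +-cancelˡ-≤ (k C i) _ _ (begin
  k C i + domCount G (suc i)  ≤⟨ +-monoʳ-≤ (k C i) (domCount≤nCk G (suc i)) ⟩
  k C i + n C suc i           ≡⟨ +-comm (k C i) (n C suc i) ⟩
  n C suc i + k C i           ≤⟨ NC[k+1]+nCk≤NCk {n = k} {m} i+j≡n k+m≡n
                                   (belowRoot⇒j^m*i+j*n^m<n^m*i {m} i+j≡n (m<n⇒0<n∸m i<n) below) ⟩
  n C i                       ≤⟨ nCk≤∣nonUniversal∣Ck+domCount G i ⟩
  k C i + domCount G i        ∎)
  where
  open ≤-Reasoning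
  n = suc d
  k = ∣ nonUniversal G ∣
  i+j≡n : i + (n ∸ i) ≡ n
  i+j≡n = m+[n∸m]≡n (<⇒≤ i<n)
  k+m≡n : k + m ≡ n
  k+m≡n = subst (λ m → k + m ≡ n) #universal≡m (∣nonUniversal∣+numUniversal≡n G)
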